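{- For every natural number $n$, let $a(n)=\sum_{d\mid n,\ 1\le d\le\sqrt{n}} d$. If $m$ and $n$ are relatively prime natural numbers, then $a(mn)\ge a(m)a(n)$. -}

module Defs where

open import Data.Nat using (ℕ; suc; _*_; _≤_; _≤?_)
open import Data.Nat.Divisibility using (_∣_; _∣?_)
open import Data.List using (List; filter; map; upTo)
open import Data.Nat.ListAction using (sum)
open import Data.Product using (_×_)
open import Relation.Nullary.Decidable using (_×-dec_)

-- The divisors d of n with 1 ≤ d and d ≤ √n (i.e. d * d ≤ n).
-- Candidates: d ∈ {1, …, n}  (upTo n = [0 … n-1], shifted by suc).
smallDivisors : ℕ → List ℕ
smallDivisors n = filter (λ d → (d ∣? n) ×-dec (d * d ≤? n)) (map suc (upTo n))

a : ℕ → ℕ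
a n = sum (smallDivisors n)

{-# OPTIONS --safe #-}
-- The products d e of a small divisor d of m and a small divisor e of n are
-- small divisors of m n, and they sum to a(m) a(n). For coprime m and n the
-- map (d , e) ↦ d e is injective, since d ∣ d' e' together with gcd(d, e') = 1
-- forces d ∣ d'. Distinct small divisors of m n sum to at most a(m n).
module Submission where

open import Defs
open import Data.Nat using (ℕ; suc; _+_; _*_; _≤_; _<_; _≥_; _≤?_; s≤s; z≤n)
open import Data.Nat.Properties
  using (+-assoc; +-comm; +-monoʳ-≤; *-zeroʳ; *-distribˡ-+; *-distribʳ-+; *-comm; *-mono-≤;
         m≤m*n; ≤-trans; [m*n]*[o*p]≡[m*o]*[n*p]; suc-injective)
open import Data.Nat.Divisibility using (_∣_; _∣?_; ∣-trans; ∣-antisym; m∣m*n; *-pres-∣)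
open import Data.Nat.Coprimality as Coprimality using (Coprime; coprime-divisor)
open import Data.Nat.ListAction using (sum)
open import Data.Nat.ListAction.Properties using (sum-++)
open import Data.List using (List; []; _∷_; _++_; map; filter; upTo; cartesianProduct)
open import Data.List.Properties using (map-++; map-∘)
open import Data.List.Membership.Propositional using (_∈_; _─_)
open import Data.List.Membership.Propositional.Properties
  using (∈-filter⁺; ∈-filter⁻; ∈-map⁺; ∈-map⁻; ∈-upTo⁺; ∈-cartesianProduct⁻)
open import Data.List.Relation.Binary.Subset.Propositional using (_⊆_)
open import Data.List.Relation.Unary.Any using (here; there)
import Data.List.Relation.Unary.All as All
import Data.List.Relation.Unary.All.Properties as All
open import Data.List.Relation.Unary.AllPairs using ([]; _∷_)
open import Data.List.Relation.Unary.Unique.Propositional using (Unique)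
import Data.List.Relation.Unary.Unique.Propositional.Properties as Unique
open import Data.Product using (_×_; _,_; uncurry)
open import Relation.Nullary.Decidable using (Dec; _×-dec_)
open import Relation.Binary.PropositionalEquality
  using (_≡_; _≢_; refl; sym; trans; cong; cong₂; subst; module ≡-Reasoning)
open import Data.Empty using (⊥-elim)

sum-─ : ∀ {x} xs (x∈xs : x ∈ xs) → sum xs ≡ x + sum (xs ─ x∈xs)
sum-─ (y ∷ xs) (here refl) = refl
sum-─ {x} (y ∷ xs) (there x∈xs) = begin
  y + sum xs                    ≡⟨ cong (y +_) (sum-─ xs x∈xs) ⟩
  y + (x + sum (xs ─ x∈xs))     ≡⟨ +-assoc y x _ ⟨
  (y + x) + sum (xs ─ x∈xs)     ≡⟨ cong (_+ sum (xs ─ x∈xs)) (+-comm y x) ⟩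
  (x + y) + sum (xs ─ x∈xs)     ≡⟨ +-assoc x y _ ⟩
  x + (y + sum (xs ─ x∈xs))     ∎
  where open ≡-Reasoning

∈-─⁺ : ∀ {A : Set} {x y : A} {xs} (x∈xs : x ∈ xs) → y ∈ xs → x ≢ y → y ∈ xs ─ x∈xs
∈-─⁺ (here refl) (here refl)  x≢y = ⊥-elim (x≢y refl)
∈-─⁺ (here refl) (there y∈xs) x≢y = y∈xs
∈-─⁺ (there x∈xs) (here refl) x≢y = here refl
∈-─⁺ (there x∈xs) (there y∈xs) x≢y = there (∈-─⁺ x∈xs y∈xs x≢y)

sum-mono-⊆ : ∀ {xs ys} → Unique xs → xs ⊆ ys → sum xs ≤ sum ys
sum-mono-⊆ {[]} [] _ = z≤n
sum-mono-⊆ {x ∷ xs} {ys} (x∉xs ∷ xs!) x∷xs⊆ys =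
  subst (x + sum xs ≤_) (sym (sum-─ ys x∈ys)) (+-monoʳ-≤ x (sum-mono-⊆ xs! xs⊆ys─x))
  where
  x∈ys : x ∈ ys
  x∈ys = x∷xs⊆ys (here refl)
  xs⊆ys─x : xs ⊆ ys ─ x∈ys
  xs⊆ys─x y∈xs = ∈-─⁺ x∈ys (x∷xs⊆ys (there y∈xs)) (All.lookup x∉xs y∈xs)

Unique-map⁺ : ∀ {A B : Set} {f : A → B} {xs} →
              (∀ {x y} → x ∈ xs → y ∈ xs → f x ≡ f y → x ≡ y) →
              Unique xs → Unique (map f xs)
Unique-map⁺ {xs = []} _ [] = []
Unique-map⁺ {f = f} {xs = x ∷ xs} f-inj (x∉xs ∷ xs!) =
  All.map⁺ (All.tabulate fx≢f·) ∷ Unique-map⁺ (λ x∈ y∈ → f-inj (there x∈) (there y∈)) xs!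
  where
  fx≢f· : ∀ {y} → y ∈ xs → f x ≢ f y
  fx≢f· y∈xs fx≡fy = All.lookup x∉xs y∈xs (f-inj (here refl) (there y∈xs) fx≡fy)

sum-map-*ˡ : ∀ m ns → sum (map (m *_) ns) ≡ m * sum ns
sum-map-*ˡ m []       = sym (*-zeroʳ m)
sum-map-*ˡ m (n ∷ ns) = trans (cong (m * n +_) (sum-map-*ˡ m ns)) (sym (*-distribˡ-+ m n (sum ns)))

sum-cartesianProduct-* : ∀ ms ns → sum (map (uncurry _*_) (cartesianProduct ms ns)) ≡ sum ms * sum ns
sum-cartesianProduct-* []       ns = refl
sum-cartesianProduct-* (m ∷ ms) ns = begin
  sum (map (uncurry _*_) (map (m ,_) ns ++ cartesianProduct ms ns))
    ≡⟨ cong sum (map-++ (uncurry _*_) (map (m ,_) ns) _) ⟩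
  sum (map (uncurry _*_) (map (m ,_) ns) ++ map (uncurry _*_) (cartesianProduct ms ns))
    ≡⟨ sum-++ (map (uncurry _*_) (map (m ,_) ns)) _ ⟩
  sum (map (uncurry _*_) (map (m ,_) ns)) + sum (map (uncurry _*_) (cartesianProduct ms ns))
    ≡⟨ cong₂ _+_ (trans (cong sum (sym (map-∘ ns))) (sum-map-*ˡ m ns)) (sum-cartesianProduct-* ms ns) ⟩
  m * sum ns + sum ms * sum ns
    ≡⟨ *-distribʳ-+ (sum ns) m (sum ms) ⟨
  (m + sum ms) * sum ns ∎
  where open ≡-Reasoning

IsSmallDivisor : ℕ → ℕ → Set
IsSmallDivisor n d = 1 ≤ d × d ∣ n × d * d ≤ n

smallDivisor? : ∀ n d → Dec (d ∣ n × d * d ≤ n)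
smallDivisor? n d = (d ∣? n) ×-dec (d * d ≤? n)

∈-smallDivisors⁻ : ∀ {n d} → d ∈ smallDivisors n → IsSmallDivisor n d
∈-smallDivisors⁻ {n} d∈ with ∈-filter⁻ (smallDivisor? n) {xs = map suc (upTo n)} d∈
... | d∈suc[upTo] , d∣n , d²≤n with ∈-map⁻ suc d∈suc[upTo]
... | _ , _ , refl = s≤s z≤n , d∣n , d²≤n

∈-smallDivisors⁺ : ∀ {n d} → IsSmallDivisor n d → d ∈ smallDivisors n
∈-smallDivisors⁺ {n} {suc k} (_ , d∣n , d²≤n) =
  ∈-filter⁺ (smallDivisor? n) (∈-map⁺ suc (∈-upTo⁺ k<n)) (d∣n , d²≤n)
  where
  k<n : k < n
  k<n = ≤-trans (m≤m*n (suc k) (suc k)) d²≤n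

smallDivisors-unique : ∀ n → Unique (smallDivisors n)
smallDivisors-unique n =
  Unique.filter⁺ (smallDivisor? n) (Unique.map⁺ suc-injective (Unique.upTo⁺ n))

IsSmallDivisor-* : ∀ {m n d e} → IsSmallDivisor m d → IsSmallDivisor n e → IsSmallDivisor (m * n) (d * e)
IsSmallDivisor-* {m} {n} {d} {e} (1≤d , d∣m , d²≤m) (1≤e , e∣n , e²≤n) =
  *-mono-≤ 1≤d 1≤e , *-pres-∣ d∣m e∣n ,
  subst (_≤ m * n) (sym ([m*n]*[o*p]≡[m*o]*[n*p] d e d e)) (*-mono-≤ d²≤m e²≤n)

∣-of-coprime-factorisations : ∀ {m n d d′ e e′} → Coprime m n → d ∣ m → e′ ∣ n →
                              d * e ≡ d′ * e′ → d ∣ d′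
∣-of-coprime-factorisations {d = d} {d′} {e} {e′} m⊥n d∣m e′∣n de≡d′e′ =
  coprime-divisor d⊥e′ (subst (d ∣_) (trans de≡d′e′ (*-comm d′ e′)) (m∣m*n e))
  where
  d⊥e′ : Coprime d e′
  d⊥e′ (c∣d , c∣e′) = m⊥n (∣-trans c∣d d∣m , ∣-trans c∣e′ e′∣n)

coprime-factorisation-unique : ∀ {m n d d′ e e′} → Coprime m n →
                               d ∣ m → d′ ∣ m → e ∣ n → e′ ∣ n →
                               d * e ≡ d′ * e′ → d ≡ d′ × e ≡ e′
coprime-factorisation-unique {m} {n} {d} {d′} {e} {e′} m⊥n d∣m d′∣m e∣n e′∣n de≡d′e′ =
  ∣-antisym (∣-of-coprime-factorisations m⊥n d∣m e′∣n de≡d′e′)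
            (∣-of-coprime-factorisations m⊥n d′∣m e∣n (sym de≡d′e′)) ,
  ∣-antisym (∣-of-coprime-factorisations n⊥m e∣n d′∣m ed≡e′d′)
            (∣-of-coprime-factorisations n⊥m e′∣n d∣m (sym ed≡e′d′))
  where
  n⊥m : Coprime n m
  n⊥m = Coprimality.sym m⊥n
  ed≡e′d′ : e * d ≡ e′ * d′
  ed≡e′d′ = trans (*-comm e d) (trans de≡d′e′ (*-comm d′ e′))

lemma1p1 : (m n : ℕ) → Coprime m n → a (m * n) ≥ a m * a n
lemma1p1 m n m⊥n =
  subst (_≤ a (m * n)) (sum-cartesianProduct-* (smallDivisors m) (smallDivisors n))
    (sum-mono-⊆ (Unique-map⁺ product-injective pairs-unique) products-small)
  where
  pairs : List (ℕ × ℕ)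
  pairs = cartesianProduct (smallDivisors m) (smallDivisors n)

  pairs-unique : Unique pairs
  pairs-unique = Unique.cartesianProduct⁺ (smallDivisors-unique m) (smallDivisors-unique n)

  pair-small : ∀ {d e} → (d , e) ∈ pairs → IsSmallDivisor m d × IsSmallDivisor n e
  pair-small de∈ with d∈ , e∈ ← ∈-cartesianProduct⁻ (smallDivisors m) (smallDivisors n) de∈ =
    ∈-smallDivisors⁻ d∈ , ∈-smallDivisors⁻ e∈

  product-injective : ∀ {p q} → p ∈ pairs → q ∈ pairs → uncurry _*_ p ≡ uncurry _*_ q → p ≡ q
  product-injective {_ , _} {_ , _} p∈ q∈ de≡d′e′
    with (_ , d∣m , _) , (_ , e∣n , _) ← pair-small p∈
       | (_ , d′∣m , _) , (_ , e′∣n , _) ← pair-small q∈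
    with refl , refl ← coprime-factorisation-unique m⊥n d∣m d′∣m e∣n e′∣n de≡d′e′ = refl

  products-small : map (uncurry _*_) pairs ⊆ smallDivisors (m * n)
  products-small de∈ with (_ , _) , p∈ , refl ← ∈-map⁻ (uncurry _*_) de∈ =
    ∈-smallDivisors⁺ (uncurry IsSmallDivisor-* (pair-small p∈))
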